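{- Let $H$ be a graph. If the class $\mathrm{Excl}(H)$ is well-quasi-ordered by the contraction relation, then $H$ is a contraction of the diamond $D_2$.
   Context: Graphs are finite, simple, up to isomorphism. Contracting an edge $\{u,v\}$ means adding a new vertex adjacent to all neighbours of $u$ and $v$ and deleting $u,v$; $H$ is a contraction of $G$ if obtained by a sequence of edge contractions. $\mathrm{Excl}(H)$ is the class of connected graphs not having $H$ as a contraction. The diamond $D_2$ is $K_4$ minus an edge. A well-quasi-order is a quasi-order with no infinite strictly decreasing sequence and no infinite antichain. -}

module Defs where

open import Data.Nat using (ℕ; zero; suc)
open import Data.Fin using (Fin; zero; suc)
open import Data.Bool using (Bool; true; false)
open import Data.Product using (Σ; ∃; ∃-syntax; _×_; _,_)
open import Data.Sum using (_⊎_)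
open import Relation.Binary.PropositionalEquality using (_≡_; _≢_; refl)
open import Relation.Nullary using (¬_)
open import Function.Bundles using (_⇔_)

record Graph : Set where
  field
    size  : ℕ
    adj   : Fin size → Fin size → Bool
    sym   : ∀ x y → adj x y ≡ adj y x
    irrefl : ∀ x → adj x x ≡ false
open Graph public

Edge : (G : Graph) → Fin (size G) → Fin (size G) → Set
Edge G x y = adj G x y ≡ true

record _≅_ (H G : Graph) : Set where
  field
    to      : Fin (size H) → Fin (size G)
    from    : Fin (size G) → Fin (size H)
    to-from : ∀ y → to (from y) ≡ y
    from-to : ∀ x → from (to x) ≡ x
    preserves : ∀ x y → adj G (to x) (to y) ≡ adj H x y

data Reach (G : Graph) : Fin (size G) → Fin (size G) → Set where
  here : ∀ {x} → Reach G x x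
  step : ∀ {x y z} → Edge G x y → Reach G y z → Reach G x z

Connected : Graph → Set
Connected G = ∀ x y → Reach G x y

-- K is (isomorphic to) the graph obtained from G by contracting the edge {u,v}:
-- f identifies exactly u and v into a single new vertex and is otherwise a
-- bijection, and two distinct vertices of K are adjacent iff some of their
-- preimages are adjacent in G (so the new vertex is adjacent to all
-- neighbours of u and v, other than u and v themselves).
record ContractsEdge (G K : Graph) (u v : Fin (size G)) : Set where
  field
    uv-edge : Edge G u v
    f       : Fin (size G) → Fin (size K)
    onto    : ∀ b → ∃[ x ] f x ≡ b
    merge   : f u ≡ f v
    almost-injective : ∀ x y → f x ≡ f y →
                       x ≡ y ⊎ ((x ≡ u × y ≡ v) ⊎ (x ≡ v × y ≡ u))
    adjacency : ∀ a b → a ≢ b →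
                (Edge K a b ⇔ (∃[ x ] ∃[ y ] (f x ≡ a × f y ≡ b × Edge G x y)))

_⟶_ : Graph → Graph → Set
G ⟶ K = ∃[ u ] ∃[ v ] ContractsEdge G K u v

data _≼_ (H : Graph) : Graph → Set where
  iso  : ∀ {G} → H ≅ G → H ≼ G
  step : ∀ {G K} → G ⟶ K → H ≼ K → H ≼ G

Excl : Graph → Graph → Set
Excl H G = Connected G × ¬ (H ≼ G)

WQO-≼ : (Graph → Set) → Set
WQO-≼ P =
  (¬ (Σ (ℕ → Graph) λ s → (∀ i → P (s i)) ×
        (∀ i → (s (suc i) ≼ s i) × ¬ (s i ≼ s (suc i)))))
  × (¬ (Σ (ℕ → Graph) λ s → (∀ i → P (s i)) ×
        (∀ i j → i ≢ j → ¬ (s i ≼ s j))))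

-- The diamond D₂ = K₄ minus the edge {2,3}.
adjD₂ : Fin 4 → Fin 4 → Bool
adjD₂ zero zero = false
adjD₂ zero _ = true
adjD₂ (suc zero) (suc zero) = false
adjD₂ (suc zero) _ = true
adjD₂ (suc (suc zero)) zero = true
adjD₂ (suc (suc zero)) (suc zero) = true
adjD₂ (suc (suc zero)) _ = false
adjD₂ (suc (suc (suc zero))) zero = true
adjD₂ (suc (suc (suc zero))) (suc zero) = true
adjD₂ (suc (suc (suc zero))) _ = false

adjD₂-sym : ∀ x y → adjD₂ x y ≡ adjD₂ y x
adjD₂-sym zero zero = refl
adjD₂-sym zero (suc zero) = refl
adjD₂-sym zero (suc (suc zero)) = refl
adjD₂-sym zero (suc (suc (suc zero))) = refl
adjD₂-sym (suc zero) zero = refl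
adjD₂-sym (suc zero) (suc zero) = refl
adjD₂-sym (suc zero) (suc (suc zero)) = refl
adjD₂-sym (suc zero) (suc (suc (suc zero))) = refl
adjD₂-sym (suc (suc zero)) zero = refl
adjD₂-sym (suc (suc zero)) (suc zero) = refl
adjD₂-sym (suc (suc zero)) (suc (suc zero)) = refl
adjD₂-sym (suc (suc zero)) (suc (suc (suc zero))) = refl
adjD₂-sym (suc (suc (suc zero))) zero = refl
adjD₂-sym (suc (suc (suc zero))) (suc zero) = refl
adjD₂-sym (suc (suc (suc zero))) (suc (suc zero)) = refl
adjD₂-sym (suc (suc (suc zero))) (suc (suc (suc zero))) = refl

adjD₂-irrefl : ∀ x → adjD₂ x x ≡ false
adjD₂-irrefl zero = refl
adjD₂-irrefl (suc zero) = refl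
adjD₂-irrefl (suc (suc zero)) = refl
adjD₂-irrefl (suc (suc (suc zero))) = refl

D₂ : Graph
D₂ = record { size = 4 ; adj = adjD₂ ; sym = adjD₂-sym ; irrefl = adjD₂-irrefl }

-- A complete multipartite graph all of whose parts have at least two vertices has no
-- universal vertex, whereas every proper contraction of a complete multipartite graph
-- has one: the contracted edge joins two parts, and the merged vertex sees all others.
-- So such graphs of different orders are incomparable. The graphs K₂,ₙ have a vertex
-- cover of size 2 and the cocktail party graphs K₂,…,₂ have no independent set of
-- size 3, both properties being closed under contraction. If H had no universal vertex,
-- were not complete multipartite, or lacked one of these two properties, the large
-- members of one family would form an infinite antichain in Excl(H). Hence H has all
-- four properties; then H has at most four vertices, and checking all graphs on at most
-- four vertices leaves K₁, K₂, K₃, P₃ and D₂, all contractions of D₂.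

module Submission where

open import Defs hiding (sym)
open import Data.Nat as ℕ using (ℕ; zero; suc; _+_; _*_; _≤_; _<_; z≤n; s≤s)
import Data.Nat.Properties as ℕ
open import Data.Fin as Fin using (Fin; zero; suc; #_; toℕ; punchIn; inject≤; combine; remQuot)
import Data.Fin.Properties as Fin
open import Data.Bool using (Bool; true; false; not)
open import Data.Bool.Properties using (¬-not) renaming (_≟_ to _≟ᵇ_)
open import Data.Product using (Σ; ∃-syntax; _×_; _,_; proj₁; proj₂)
open import Data.Sum as Sum using (_⊎_; inj₁; inj₂)
open import Data.Unit using (⊤; tt)
open import Data.Vec as Vec using (Vec; []; _∷_)
import Data.Vec.Properties as Vec
open import Data.List using (List; []; _∷_)
open import Data.List.Relation.Unary.Any as Any using (Any)
open import Function.Base using (_∘_)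
open import Function.Bundles using (mk⇔; Equivalence)
open import Function.Definitions using (Injective)
open import Relation.Binary.PropositionalEquality
  using (_≡_; _≢_; refl; sym; trans; cong; cong₂; subst)
open import Relation.Nullary using (¬_; Dec; yes; no; does; contradiction)
open import Relation.Nullary.Decidable as Dec
  using (True; toWitness; decidable-stable; dec-true; dec-false; ¬?; _×-dec_; _⊎-dec_; _→-dec_)

≅-refl : ∀ {G} → G ≅ G
≅-refl = record
  { to = λ x → x ; from = λ x → x ; to-from = λ _ → refl ; from-to = λ _ → refl
  ; preserves = λ _ _ → refl }

≅-sym : ∀ {H G} → H ≅ G → G ≅ H
≅-sym {H} {G} I = record
  { to = from ; from = to ; to-from = from-to ; from-to = to-from
  ; preserves = λ x y →
      trans (sym (preserves (from x) (from y))) (cong₂ (adj G) (to-from x) (to-from y)) }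
  where open _≅_ I

≅-trans : ∀ {A B C} → A ≅ B → B ≅ C → A ≅ C
≅-trans I J = record
  { to = J.to ∘ I.to ; from = I.from ∘ J.from
  ; to-from = λ y → trans (cong J.to (I.to-from (J.from y))) (J.to-from y)
  ; from-to = λ x → trans (cong I.from (J.from-to (I.to x))) (I.from-to x)
  ; preserves = λ x y → trans (J.preserves (I.to x) (I.to y)) (I.preserves x y) }
  where module I = _≅_ I ; module J = _≅_ J

module _ {H G : Graph} (I : H ≅ G) where
  open _≅_ I

  to-injective : Injective _≡_ _≡_ to
  to-injective {x} {y} e = trans (sym (from-to x)) (trans (cong from e) (from-to y))

  from-injective : Injective _≡_ _≡_ from
  from-injective {x} {y} e = trans (sym (to-from x)) (trans (cong to e) (to-from y))

  ≅⇒size≡ : size H ≡ size G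
  ≅⇒size≡ = ℕ.≤-antisym (Fin.injective⇒≤ to-injective) (Fin.injective⇒≤ from-injective)

≼-respˡ-≅ : ∀ {A B G} → A ≅ B → B ≼ G → A ≼ G
≼-respˡ-≅ I (iso J)    = iso (≅-trans I J)
≼-respˡ-≅ I (step s r) = step s (≼-respˡ-≅ I r)

module Contraction {G K : Graph} {u v : Fin (size G)} (C : ContractsEdge G K u v) where
  open ContractsEdge C public

  section : Fin (size K) → Fin (size G)
  section b = proj₁ (onto b)

  f∘section : ∀ b → f (section b) ≡ b
  f∘section b = proj₂ (onto b)

  section-injective : Injective _≡_ _≡_ section
  section-injective {a} {b} e = trans (sym (f∘section a)) (trans (cong f e) (f∘section b))

  edge-image : ∀ {x y a b} → f x ≡ a → f y ≡ b → a ≢ b → Edge G x y → Edge K a b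
  edge-image fx fy a≢b e = Equivalence.from (adjacency _ _ a≢b) (_ , _ , fx , fy , e)

  edge-preimage : ∀ {a b} → a ≢ b → Edge K a b → ∃[ x ] ∃[ y ] (f x ≡ a × f y ≡ b × Edge G x y)
  edge-preimage a≢b = Equivalence.to (adjacency _ _ a≢b)

  section-edge : ∀ {a b} → a ≢ b → Edge G (section a) (section b) → Edge K a b
  section-edge = edge-image (f∘section _) (f∘section _)

record ≼-Closed (P : Graph → Set) : Set where
  field
    resp-≅ : ∀ {H G} → H ≅ G → P G → P H
    resp-⟶ : ∀ {G K} → G ⟶ K → P G → P K

≼-closed : ∀ {P} → ≼-Closed P → ∀ {H G} → H ≼ G → P G → P H
≼-closed P-closed (iso I)    = ≼-Closed.resp-≅ P-closed I
≼-closed P-closed (step s r) = ≼-closed P-closed r ∘ ≼-Closed.resp-⟶ P-closed s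

-- Four contraction-closed properties

HasUniversalVertex : Graph → Set
HasUniversalVertex G = ∃[ w ] ∀ x → x ≢ w → Edge G x w

-- Non-adjacency together with equality is an equivalence relation; its classes are the parts.
IsCompleteMultipartite : Graph → Set
IsCompleteMultipartite G =
  ∀ x y z → x ≢ z → adj G x y ≡ false → adj G y z ≡ false → adj G x z ≡ false

_∈[_,_] : ∀ {n} → Fin n → Fin n → Fin n → Set
x ∈[ a , b ] = x ≡ a ⊎ x ≡ b

HasVertexCover₂ : Graph → Set
HasVertexCover₂ G = ∃[ a ] ∃[ b ] ∀ x y → Edge G x y → x ∈[ a , b ] ⊎ y ∈[ a , b ]

NoIndependentTriple : Graph → Set
NoIndependentTriple G =
  ∀ x y z → x ≢ y → y ≢ z → x ≢ z → Edge G x y ⊎ Edge G y z ⊎ Edge G x z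

universal-closed : ≼-Closed HasUniversalVertex
universal-closed = record { resp-≅ = resp-≅ ; resp-⟶ = resp-⟶ }
  where
  resp-≅ : ∀ {H G} → H ≅ G → HasUniversalVertex G → HasUniversalVertex H
  resp-≅ {H} {G} I (w , universal) = from w , λ x x≢ →
    trans (sym (preserves x (from w)))
      (subst (Edge G (to x)) (sym (to-from w))
        (universal (to x) (λ e → x≢ (trans (sym (from-to x)) (cong from e)))))
    where open _≅_ I

  resp-⟶ : ∀ {G K} → G ⟶ K → HasUniversalVertex G → HasUniversalVertex K
  resp-⟶ (_ , _ , C) (w , universal) = f w , λ b b≢ →
    edge-image (f∘section b) refl b≢
      (universal (section b) (λ e → b≢ (trans (sym (f∘section b)) (cong f e))))
    where open Contraction C

multipartite-closed : ≼-Closed IsCompleteMultipartite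
multipartite-closed = record { resp-≅ = resp-≅ ; resp-⟶ = resp-⟶ }
  where
  resp-≅ : ∀ {H G} → H ≅ G → IsCompleteMultipartite G → IsCompleteMultipartite H
  resp-≅ I cm x y z x≢z xy yz =
    trans (sym (preserves x z))
      (cm (to x) (to y) (to z) (x≢z ∘ to-injective I)
        (trans (preserves x y) xy) (trans (preserves y z) yz))
    where open _≅_ I

  -- An edge p r of K lifts to an edge x z of G, and transitivity in G makes the
  -- preimage of q adjacent to x or to z, hence q adjacent to p or to r.
  resp-⟶ : ∀ {G K} → G ⟶ K → IsCompleteMultipartite G → IsCompleteMultipartite K
  resp-⟶ {G} {K} (_ , _ , C) cm = transitive
    where
    open Contraction C
    transitive : IsCompleteMultipartite K
    transitive p q r p≢r pq qr with adj K p r in pr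
    ... | false = refl
    ... | true with q Fin.≟ p | q Fin.≟ r
    ...   | yes refl | _        = trans (sym pr) qr
    ...   | no _     | yes refl = trans (sym pr) pq
    ...   | no q≢p   | no q≢r   with edge-preimage p≢r pr
    ...     | x , z , fx , fz , xz = trans (sym xz) (cm x (section q) z x≢z xq qz)
      where
      x≢z : x ≢ z
      x≢z e = p≢r (trans (sym fx) (trans (cong f e) fz))
      xq : adj G x (section q) ≡ false
      xq = ¬-not λ e → contradiction (trans (sym pq) (edge-image fx (f∘section q) (q≢p ∘ sym) e)) λ ()
      qz : adj G (section q) z ≡ false
      qz = ¬-not λ e → contradiction (trans (sym qr) (edge-image (f∘section q) fz q≢r e)) λ ()

vertexCover₂-closed : ≼-Closed HasVertexCover₂
vertexCover₂-closed = record { resp-≅ = resp-≅ ; resp-⟶ = resp-⟶ }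
  where
  resp-≅ : ∀ {H G} → H ≅ G → HasVertexCover₂ G → HasVertexCover₂ H
  resp-≅ I (a , b , cover) = from a , from b , λ x y e →
    Sum.map (Sum.map back back) (Sum.map back back)
      (cover (to x) (to y) (trans (preserves x y) e))
    where
    open _≅_ I
    back : ∀ {x c} → to x ≡ c → x ≡ from c
    back {x} e = trans (sym (from-to x)) (cong from e)

  resp-⟶ : ∀ {G K} → G ⟶ K → HasVertexCover₂ G → HasVertexCover₂ K
  resp-⟶ {G} {K} (_ , _ , C) (a , b , cover) = f a , f b , cover′
    where
    open Contraction C
    image : ∀ {x p c} → f x ≡ p → x ≡ c → p ≡ f c
    image fx refl = sym fx
    cover′ : ∀ p q → Edge K p q → p ∈[ f a , f b ] ⊎ q ∈[ f a , f b ]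
    cover′ p q e with p Fin.≟ q
    ... | yes refl = contradiction (trans (sym e) (Graph.irrefl K p)) λ ()
    ... | no p≢q with edge-preimage p≢q e
    ...   | x , y , fx , fy , xy =
      Sum.map (Sum.map (image fx) (image fx)) (Sum.map (image fy) (image fy)) (cover x y xy)

independence-closed : ≼-Closed NoIndependentTriple
independence-closed = record { resp-≅ = resp-≅ ; resp-⟶ = resp-⟶ }
  where
  resp-≅ : ∀ {H G} → H ≅ G → NoIndependentTriple G → NoIndependentTriple H
  resp-≅ {H} {G} I noTriple x y z x≢y y≢z x≢z =
    Sum.map (back x y) (Sum.map (back y z) (back x z))
      (noTriple (to x) (to y) (to z)
        (x≢y ∘ to-injective I) (y≢z ∘ to-injective I) (x≢z ∘ to-injective I))
    where
    open _≅_ I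
    back : ∀ x y → Edge G (to x) (to y) → Edge H x y
    back x y e = trans (sym (preserves x y)) e

  resp-⟶ : ∀ {G K} → G ⟶ K → NoIndependentTriple G → NoIndependentTriple K
  resp-⟶ (_ , _ , C) noTriple p q r p≢q q≢r p≢r =
    Sum.map (section-edge p≢q) (Sum.map (section-edge q≢r) (section-edge p≢r))
      (noTriple (section p) (section q) (section r)
        (p≢q ∘ section-injective) (q≢r ∘ section-injective) (p≢r ∘ section-injective))
    where open Contraction C

hasUniversalVertex? : ∀ G → Dec (HasUniversalVertex G)
hasUniversalVertex? G =
  Fin.any? λ w → Fin.all? λ x → ¬? (x Fin.≟ w) →-dec (adj G x w ≟ᵇ true)

isCompleteMultipartite? : ∀ G → Dec (IsCompleteMultipartite G)
isCompleteMultipartite? G = Fin.all? λ x → Fin.all? λ y → Fin.all? λ z →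
  ¬? (x Fin.≟ z) →-dec (adj G x y ≟ᵇ false) →-dec (adj G y z ≟ᵇ false) →-dec (adj G x z ≟ᵇ false)

hasVertexCover₂? : ∀ G → Dec (HasVertexCover₂ G)
hasVertexCover₂? G = Fin.any? λ a → Fin.any? λ b → Fin.all? λ x → Fin.all? λ y →
  (adj G x y ≟ᵇ true) →-dec ((x Fin.≟ a ⊎-dec x Fin.≟ b) ⊎-dec (y Fin.≟ a ⊎-dec y Fin.≟ b))

noIndependentTriple? : ∀ G → Dec (NoIndependentTriple G)
noIndependentTriple? G = Fin.all? λ x → Fin.all? λ y → Fin.all? λ z →
  ¬? (x Fin.≟ y) →-dec ¬? (y Fin.≟ z) →-dec ¬? (x Fin.≟ z) →-dec
  (adj G x y ≟ᵇ true ⊎-dec adj G y z ≟ᵇ true ⊎-dec adj G x z ≟ᵇ true)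

completeMultipartite : (n : ℕ) → (Fin n → ℕ) → Graph
completeMultipartite n part = record
  { size = n
  ; adj = λ x y → not (does (part x ℕ.≟ part y))
  ; sym = λ x y → cong not (does-sym (part x) (part y))
  ; irrefl = λ x → cong not (dec-true (part x ℕ.≟ part x) refl) }
  where
  does-sym : ∀ i j → does (i ℕ.≟ j) ≡ does (j ℕ.≟ i)
  does-sym i j with i ℕ.≟ j
  ... | yes i≡j = trans (dec-true (i ℕ.≟ j) i≡j) (sym (dec-true (j ℕ.≟ i) (sym i≡j)))
  ... | no i≢j  = trans (dec-false (i ℕ.≟ j) i≢j) (sym (dec-false (j ℕ.≟ i) (i≢j ∘ sym)))

module _ {n : ℕ} (part : Fin n → ℕ) where
  private
    G = completeMultipartite n part

  multipartite-edge : ∀ {x y} → part x ≢ part y → Edge G x y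
  multipartite-edge {x} {y} ne = cong not (dec-false (part x ℕ.≟ part y) ne)

  multipartite-nonEdge : ∀ {x y} → part x ≡ part y → adj G x y ≡ false
  multipartite-nonEdge {x} {y} e = cong not (dec-true (part x ℕ.≟ part y) e)

  multipartite-nonEdge⁻¹ : ∀ {x y} → adj G x y ≡ false → part x ≡ part y
  multipartite-nonEdge⁻¹ {x} {y} nonEdge with part x ℕ.≟ part y
  ... | yes same = same
  ... | no ne    = contradiction (trans (sym (multipartite-edge ne)) nonEdge) λ ()

  completeMultipartite-isCompleteMultipartite : IsCompleteMultipartite G
  completeMultipartite-isCompleteMultipartite _ _ _ _ xy yz =
    multipartite-nonEdge (trans (multipartite-nonEdge⁻¹ xy) (multipartite-nonEdge⁻¹ yz))

  completeMultipartite-connected : ∀ a b → part a ≢ part b → Connected G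
  completeMultipartite-connected a b a≢b x y with x Fin.≟ y | part x ℕ.≟ part y
  ... | yes refl | _       = here
  ... | no _     | no x≢y  = step (multipartite-edge x≢y) here
  ... | no _     | yes x≡y with part x ℕ.≟ part a
  ...   | yes x≡a = step (multipartite-edge λ e → a≢b (trans (sym x≡a) e))
                      (step (multipartite-edge λ e → a≢b (trans (trans (sym x≡a) x≡y) (sym e))) here)
  ...   | no x≢a  = step (multipartite-edge x≢a)
                      (step (multipartite-edge λ e → x≢a (trans x≡y (sym e))) here)

  -- Contracting an edge uv merges two different parts, so the new vertex sees everything.
  ⟶-universal : ∀ {K} → G ⟶ K → HasUniversalVertex K
  ⟶-universal {K} (u , v , C) = f u , universal
    where
    open Contraction C
    u≢v : part u ≢ part v
    u≢v e = contradiction (trans (sym uv-edge) (multipartite-nonEdge e)) λ ()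
    universal : ∀ b → b ≢ f u → Edge K b (f u)
    universal b b≢ with part (section b) ℕ.≟ part u
    ... | no  b≢u = edge-image (f∘section b) refl b≢ (multipartite-edge b≢u)
    ... | yes b≡u = edge-image (f∘section b) (sym merge) b≢ (multipartite-edge (u≢v ∘ trans (sym b≡u)))

  ≼-completeMultipartite : ∀ {H} → H ≼ G → size H ≡ n ⊎ HasUniversalVertex H
  ≼-completeMultipartite (iso I)    = inj₁ (≅⇒size≡ I)
  ≼-completeMultipartite (step s r) = inj₂ (≼-closed universal-closed r (⟶-universal s))

  HasTwins : Set
  HasTwins = ∀ w → ∃[ x ] x ≢ w × part x ≡ part w

  hasTwins⇒noUniversal : HasTwins → ¬ HasUniversalVertex G
  hasTwins⇒noUniversal twins (w , universal) with twins w
  ... | x , x≢w , same = contradiction (trans (sym (universal x x≢w)) (multipartite-nonEdge same)) λ ()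

  AtMostTwoPerPart : Set
  AtMostTwoPerPart = ∀ x y z → part x ≡ part y → part y ≡ part z → x ≡ y ⊎ y ≡ z ⊎ x ≡ z

  atMostTwo⇒noIndependentTriple : AtMostTwoPerPart → NoIndependentTriple G
  atMostTwo⇒noIndependentTriple atMostTwo x y z x≢y y≢z x≢z
    with part x ℕ.≟ part y | part y ℕ.≟ part z
  ... | no ne | _     = inj₁ (multipartite-edge ne)
  ... | yes _ | no ne = inj₂ (inj₁ (multipartite-edge ne))
  ... | yes xy | yes yz with atMostTwo x y z xy yz
  ...   | inj₁ e        = contradiction e x≢y
  ...   | inj₂ (inj₁ e) = contradiction e y≢z
  ...   | inj₂ (inj₂ e) = contradiction e x≢z

-- Infinite antichains of complete multipartite graphs

Antichain : (Graph → Set) → Set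
Antichain P = Σ (ℕ → Graph) λ s → (∀ i → P (s i)) × (∀ i j → i ≢ j → ¬ (s i ≼ s j))

record TwinFamily (Q : Graph → Set) : Set where
  field
    order           : ℕ → ℕ
    order-injective : Injective _≡_ _≡_ order
    order-large     : ∀ m → m < order m
    part            : ∀ m → Fin (order m) → ℕ
    twins           : ∀ m → HasTwins (part m)
    two-parts       : ∀ m → ∃[ a ] ∃[ b ] part m a ≢ part m b
    satisfies       : ∀ m → Q (completeMultipartite (order m) (part m))

  member : ℕ → Graph
  member m = completeMultipartite (order m) (part m)

module _ {Q : Graph → Set} (Q-closed : ≼-Closed Q) (F : TwinFamily Q) where
  open TwinFamily F

  -- A proper contraction has a universal vertex, which twins forbid; an
  -- isomorphism would force equal orders.
  members-incomparable : ∀ {m m′} → m ≢ m′ → ¬ (member m ≼ member m′)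
  members-incomparable m≢m′ r with ≼-completeMultipartite (part _) r
  ... | inj₁ same-order = m≢m′ (order-injective same-order)
  ... | inj₂ universal  = hasTwins⇒noUniversal (part _) (twins _) universal

  excluding-antichain : ∀ H → ¬ (HasUniversalVertex H × IsCompleteMultipartite H × Q H) →
                        Antichain (Excl H)
  excluding-antichain H notAll =
    member ∘ shift , (λ i → connected i , excluded i) ,
    λ i j i≢j → members-incomparable (i≢j ∘ ℕ.+-cancelʳ-≡ (size H) i j)
    where
    shift : ℕ → ℕ
    shift i = i + size H

    connected : ∀ i → Connected (member (shift i))
    connected i with two-parts (shift i)
    ... | a , b , a≢b = completeMultipartite-connected (part (shift i)) a b a≢b

    excluded : ∀ i → ¬ (H ≼ member (shift i))
    excluded i r with ≼-completeMultipartite (part (shift i)) r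
    ... | inj₁ same-order = ℕ.<-irrefl same-order
          (ℕ.≤-<-trans (ℕ.m≤n+m (size H) i) (order-large (shift i)))
    ... | inj₂ universal  = notAll
          ( universal
          , ≼-closed multipartite-closed r (completeMultipartite-isCompleteMultipartite (part (shift i)))
          , ≼-closed Q-closed r (satisfies (shift i)) )

twoVersusRest : ∀ {n} → Fin (2 + n) → ℕ
twoVersusRest zero          = 0
twoVersusRest (suc zero)    = 0
twoVersusRest (suc (suc _)) = 1

K₂,ₙ-family : TwinFamily HasVertexCover₂
K₂,ₙ-family = record
  { order           = λ m → 4 + m
  ; order-injective = ℕ.+-cancelˡ-≡ 4 _ _
  ; order-large     = λ m → ℕ.m<n+m m {4} (s≤s z≤n)
  ; part            = λ m → twoVersusRest
  ; twins           = λ m → twin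
  ; two-parts       = λ m → zero , suc (suc zero) , λ ()
  ; satisfies       = λ m → zero , suc zero , cover
  }
  where
  twin : ∀ {m} → HasTwins (twoVersusRest {2 + m})
  twin zero                = suc zero , (λ ()) , refl
  twin (suc zero)          = zero , (λ ()) , refl
  twin (suc (suc zero))    = suc (suc (suc zero)) , (λ ()) , refl
  twin (suc (suc (suc _))) = suc (suc zero) , (λ ()) , refl

  cover : ∀ {m} x y → Edge (completeMultipartite (4 + m) twoVersusRest) x y →
          x ∈[ zero , suc zero ] ⊎ y ∈[ zero , suc zero ]
  cover zero          _             _ = inj₁ (inj₁ refl)
  cover (suc zero)    _             _ = inj₁ (inj₂ refl)
  cover (suc (suc _)) zero          _ = inj₂ (inj₁ refl)
  cover (suc (suc _)) (suc zero)    _ = inj₂ (inj₂ refl)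
  cover (suc (suc _)) (suc (suc _)) ()

pigeonhole₂ : (a b c : Fin 2) → a ≡ b ⊎ b ≡ c ⊎ a ≡ c
pigeonhole₂ zero       zero       _          = inj₁ refl
pigeonhole₂ (suc zero) (suc zero) _          = inj₁ refl
pigeonhole₂ _          zero       zero       = inj₂ (inj₁ refl)
pigeonhole₂ _          (suc zero) (suc zero) = inj₂ (inj₁ refl)
pigeonhole₂ zero       (suc zero) zero       = inj₂ (inj₂ refl)
pigeonhole₂ (suc zero) zero       (suc zero) = inj₂ (inj₂ refl)

-- The cocktail party graph on k pairs, with Fin (k * 2) ≅ Fin k × Fin 2 via remQuot.
module CocktailParty (k : ℕ) where

  pairOf : Fin (k * 2) → Fin k
  pairOf x = proj₁ (remQuot {k} 2 x)

  half : Fin (k * 2) → Fin 2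
  half x = proj₂ (remQuot {k} 2 x)

  part : Fin (k * 2) → ℕ
  part = toℕ ∘ pairOf

  remQuot-injective : ∀ {x y} → remQuot {k} 2 x ≡ remQuot 2 y → x ≡ y
  remQuot-injective {x} {y} e =
    trans (sym (Fin.combine-remQuot {k} 2 x))
          (trans (cong (λ (i , j) → combine i j) e) (Fin.combine-remQuot {k} 2 y))

  twins : HasTwins part
  twins x = partner , partner≢x , cong (toℕ ∘ proj₁) (Fin.remQuot-combine {k} (pairOf x) _)
    where
    partner : Fin (k * 2)
    partner = combine (pairOf x) (Fin.opposite (half x))
    opposite≢ : ∀ (j : Fin 2) → Fin.opposite j ≢ j
    opposite≢ zero       ()
    opposite≢ (suc zero) ()
    partner≢x : partner ≢ x
    partner≢x e = opposite≢ (half x)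
      (cong proj₂ (trans (sym (Fin.remQuot-combine {k} (pairOf x) _)) (cong (remQuot 2) e)))

  same-vertex : ∀ {x y} → part x ≡ part y → half x ≡ half y → x ≡ y
  same-vertex p h = remQuot-injective (cong₂ _,_ (Fin.toℕ-injective p) h)

  atMostTwo : AtMostTwoPerPart part
  atMostTwo x y z xy yz with pigeonhole₂ (half x) (half y) (half z)
  ... | inj₁ h        = inj₁ (same-vertex xy h)
  ... | inj₂ (inj₁ h) = inj₂ (inj₁ (same-vertex yz h))
  ... | inj₂ (inj₂ h) = inj₂ (inj₂ (same-vertex (trans xy yz) h))

cocktailParty-family : TwinFamily NoIndependentTriple
cocktailParty-family = record
  { order           = λ m → (2 + m) * 2
  ; order-injective = λ {m} {m′} e →
      ℕ.suc-injective (ℕ.suc-injective (ℕ.*-cancelʳ-≡ (2 + m) (2 + m′) 2 e))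
  ; order-large     = λ m → ℕ.<-≤-trans (ℕ.m<n+m m {2} (s≤s z≤n)) (ℕ.m≤m*n (2 + m) 2)
  ; part            = λ m → CocktailParty.part (2 + m)
  ; twins           = λ m → CocktailParty.twins (2 + m)
  ; two-parts       = λ m → zero , combine {2 + m} {2} (suc zero) zero , λ ()
  ; satisfies       = λ m → atMostTwo⇒noIndependentTriple _ (CocktailParty.atMostTwo (2 + m))
  }

-- Graphs on Fin n given by the bits above the diagonal of their adjacency matrix

UpperBits : ℕ → Set
UpperBits zero    = ⊤
UpperBits (suc n) = Vec Bool n × UpperBits n

bitAdj : ∀ {n} → UpperBits n → Fin n → Fin n → Bool
bitAdj (_   , _)    zero    zero    = false
bitAdj (row , _)    zero    (suc y) = Vec.lookup row y
bitAdj (row , _)    (suc x) zero    = Vec.lookup row x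
bitAdj (_   , rest) (suc x) (suc y) = bitAdj rest x y

bitAdj-sym : ∀ {n} (b : UpperBits n) x y → bitAdj b x y ≡ bitAdj b y x
bitAdj-sym _          zero    zero    = refl
bitAdj-sym _          zero    (suc _) = refl
bitAdj-sym _          (suc _) zero    = refl
bitAdj-sym (_ , rest) (suc x) (suc y) = bitAdj-sym rest x y

bitAdj-irrefl : ∀ {n} (b : UpperBits n) x → bitAdj b x x ≡ false
bitAdj-irrefl _          zero    = refl
bitAdj-irrefl (_ , rest) (suc x) = bitAdj-irrefl rest x

fromBits : (n : ℕ) → UpperBits n → Graph
fromBits n b = record { size = n ; adj = bitAdj b ; sym = bitAdj-sym b ; irrefl = bitAdj-irrefl b }

bitsOf : ∀ n → (Fin n → Fin n → Bool) → UpperBits n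
bitsOf zero    a = tt
bitsOf (suc n) a = Vec.tabulate (a zero ∘ suc) , bitsOf n (λ x y → a (suc x) (suc y))

bitAdj-bitsOf : ∀ n (a : Fin n → Fin n → Bool) → (∀ x y → a x y ≡ a y x) → (∀ x → a x x ≡ false) →
                ∀ x y → bitAdj (bitsOf n a) x y ≡ a x y
bitAdj-bitsOf (suc n) a sym′ irrefl′ zero    zero    = sym (irrefl′ zero)
bitAdj-bitsOf (suc n) a sym′ irrefl′ zero    (suc y) = Vec.lookup∘tabulate (a zero ∘ suc) y
bitAdj-bitsOf (suc n) a sym′ irrefl′ (suc x) zero    =
  trans (Vec.lookup∘tabulate (a zero ∘ suc) x) (sym′ zero (suc x))
bitAdj-bitsOf (suc n) a sym′ irrefl′ (suc x) (suc y) =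
  bitAdj-bitsOf n (λ x y → a (suc x) (suc y)) (λ x y → sym′ (suc x) (suc y)) (irrefl′ ∘ suc) x y

≅-fromBits : ∀ G → G ≅ fromBits (size G) (bitsOf (size G) (adj G))
≅-fromBits G = record
  { to = λ x → x ; from = λ x → x ; to-from = λ _ → refl ; from-to = λ _ → refl
  ; preserves = bitAdj-bitsOf (size G) (adj G) (Graph.sym G) (Graph.irrefl G) }

∀-Bool? : {P : Bool → Set} → (∀ b → Dec (P b)) → Dec (∀ b → P b)
∀-Bool? P? = Dec.map′ (λ (f , t) → λ { false → f ; true → t }) (λ h → h false , h true)
                      (P? false ×-dec P? true)

∀-Vec? : ∀ {k} {P : Vec Bool k → Set} → (∀ v → Dec (P v)) → Dec (∀ v → P v)
∀-Vec? {zero}  P? = Dec.map′ (λ p → λ { [] → p }) (λ h → h []) (P? [])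
∀-Vec? {suc k} P? = Dec.map′ (λ h → λ { (b ∷ v) → h b v }) (λ h b v → h (b ∷ v))
                              (∀-Bool? λ b → ∀-Vec? λ v → P? (b ∷ v))

∀-UpperBits? : ∀ {n} {P : UpperBits n → Set} → (∀ b → Dec (P b)) → Dec (∀ b → P b)
∀-UpperBits? {zero}  P? = Dec.map′ (λ p → λ { tt → p }) (λ h → h tt) (P? tt)
∀-UpperBits? {suc n} P? = Dec.map′ (λ h → λ (row , rest) → h row rest) (λ h row rest → h (row , rest))
                                    (∀-Vec? λ row → ∀-UpperBits? λ rest → P? (row , rest))

-- Classification of the graphs with all four properties

DiamondLike : Graph → Set
DiamondLike G = HasUniversalVertex G × IsCompleteMultipartite G × HasVertexCover₂ G × NoIndependentTriple G

diamondLike? : ∀ G → Dec (DiamondLike G)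
diamondLike? G = hasUniversalVertex? G ×-dec isCompleteMultipartite? G ×-dec
                 hasVertexCover₂? G ×-dec noIndependentTriple? G

diamondLike-resp-≅ : ∀ {H G} → H ≅ G → DiamondLike G → DiamondLike H
diamondLike-resp-≅ I (universal , multipartite , cover , noTriple) =
  ≼-Closed.resp-≅ universal-closed I universal ,
  ≼-Closed.resp-≅ multipartite-closed I multipartite ,
  ≼-Closed.resp-≅ vertexCover₂-closed I cover ,
  ≼-Closed.resp-≅ independence-closed I noTriple

restrict-avoiding : ∀ {k n} (g : Fin (suc k) → Fin n) → Injective _≡_ _≡_ g → ∀ a →
                    ∃[ σ ] Injective _≡_ _≡_ (g ∘ σ) × ∀ j → g (σ j) ≢ a
restrict-avoiding g g-injective a with Fin.any? (λ i → g i Fin.≟ a)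
... | yes (i , gi≡a) = punchIn i , Fin.punchIn-injective i _ _ ∘ g-injective ,
                       λ j e → Fin.punchInᵢ≢i i j (g-injective (trans e (sym gi≡a)))
... | no ¬hit        = suc , Fin.suc-injective ∘ g-injective , λ j e → ¬hit (suc j , e)

-- Outside a vertex cover lies an independent set.
vertexCover₂∧noIndependentTriple⇒size≤4 : ∀ {G} → HasVertexCover₂ G → NoIndependentTriple G →
                                          size G ≤ 4
vertexCover₂∧noIndependentTriple⇒size≤4 {G} (a , b , cover) noTriple = ℕ.≮⇒≥ no-five
  where
  no-five : ¬ 5 ≤ size G
  no-five 5≤size with restrict-avoiding (λ i → inject≤ i 5≤size) (Fin.inject≤-injective _ _ _ _) a
  ... | σ₁ , injective₁ , ≢a with restrict-avoiding (λ i → inject≤ (σ₁ i) 5≤size) injective₁ b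
  ...   | σ₂ , injective₂ , ≢b =
    Sum.[ no-edge , Sum.[ no-edge , no-edge ] ]
      (noTriple (h (# 0)) (h (# 1)) (h (# 2))
        ((λ ()) ∘ injective₂) ((λ ()) ∘ injective₂) ((λ ()) ∘ injective₂))
    where
    h : Fin 3 → Fin (size G)
    h i = inject≤ (σ₁ (σ₂ i)) 5≤size
    outside : ∀ i → ¬ h i ∈[ a , b ]
    outside i = Sum.[ ≢a (σ₂ i) , ≢b i ]
    no-edge : ∀ {i j} → ¬ Edge G (h i) (h j)
    no-edge {i} {j} e = Sum.[ outside i , outside j ] (cover (h i) (h j) e)

IsEdgeContraction : (G K : Graph) (u v : Fin (size G)) → (Fin (size G) → Fin (size K)) → Set
IsEdgeContraction G K u v f =
  Edge G u v × (∀ b → ∃[ x ] f x ≡ b) × f u ≡ f v ×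
  (∀ x y → f x ≡ f y → x ≡ y ⊎ (x ≡ u × y ≡ v) ⊎ (x ≡ v × y ≡ u)) ×
  (∀ a b → a ≢ b → Edge K a b → ∃[ x ] ∃[ y ] (f x ≡ a × f y ≡ b × Edge G x y)) ×
  (∀ x y → Edge G x y → f x ≢ f y → Edge K (f x) (f y))

isEdgeContraction? : ∀ G K u v f → Dec (IsEdgeContraction G K u v f)
isEdgeContraction? G K u v f =
  adj G u v ≟ᵇ true ×-dec (Fin.all? λ b → Fin.any? λ x → f x Fin.≟ b) ×-dec f u Fin.≟ f v ×-dec
  (Fin.all? λ x → Fin.all? λ y → f x Fin.≟ f y →-dec
     (x Fin.≟ y ⊎-dec (x Fin.≟ u ×-dec y Fin.≟ v) ⊎-dec (x Fin.≟ v ×-dec y Fin.≟ u))) ×-dec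
  (Fin.all? λ a → Fin.all? λ b → ¬? (a Fin.≟ b) →-dec adj K a b ≟ᵇ true →-dec
     (Fin.any? λ x → Fin.any? λ y → f x Fin.≟ a ×-dec f y Fin.≟ b ×-dec adj G x y ≟ᵇ true)) ×-dec
  (Fin.all? λ x → Fin.all? λ y →
     adj G x y ≟ᵇ true →-dec ¬? (f x Fin.≟ f y) →-dec adj K (f x) (f y) ≟ᵇ true)

contraction-by : ∀ G K u v f → {True (isEdgeContraction? G K u v f)} → G ⟶ K
contraction-by G K u v f {valid} with toWitness valid
... | uv , onto , merge , almost-injective , lift , image = u , v , record
  { uv-edge = uv ; f = f ; onto = onto ; merge = merge ; almost-injective = almost-injective
  ; adjacency = λ a b a≢b → mk⇔ (lift a b a≢b) λ { (x , y , refl , refl , xy) → image x y xy a≢b } }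

-- Restricting to involutions lets σ serve as both directions of the isomorphism.
Relabels : ∀ {n} → UpperBits n → UpperBits n → (Fin n → Fin n) → Set
Relabels b t σ = (∀ x → σ (σ x) ≡ x) × (∀ x y → bitAdj t (σ x) (σ y) ≡ bitAdj b x y)

relabels? : ∀ {n} (b t : UpperBits n) σ → Dec (Relabels b t σ)
relabels? b t σ = (Fin.all? λ x → σ (σ x) Fin.≟ x) ×-dec
                  (Fin.all? λ x → Fin.all? λ y → bitAdj t (σ x) (σ y) ≟ᵇ bitAdj b x y)

relabelling-≅ : ∀ {n} {b t : UpperBits n} {σ} → Relabels b t σ → fromBits n b ≅ fromBits n t
relabelling-≅ {σ = σ} (involutive , preserves) = record
  { to = σ ; from = σ ; to-from = involutive ; from-to = involutive ; preserves = preserves }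

ContractionOfD₂ : ℕ → Set
ContractionOfD₂ n = Σ (UpperBits n) λ t → fromBits n t ≼ D₂

RelabelsToOneOf : ∀ {n} → List (ContractionOfD₂ n) → List (Vec (Fin n) n) → UpperBits n → Set
RelabelsToOneOf targets σs b = Any (λ t → Any (λ σ → Relabels b (proj₁ t) (Vec.lookup σ)) σs) targets

relabelsToOneOf? : ∀ {n} targets σs (b : UpperBits n) → Dec (RelabelsToOneOf targets σs b)
relabelsToOneOf? targets σs b =
  Any.any? (λ t → Any.any? (λ σ → relabels? b (proj₁ t) (Vec.lookup σ)) σs) targets

relabelsToOneOf⇒≼D₂ : ∀ {n} {targets σs} {b : UpperBits n} →
                      RelabelsToOneOf targets σs b → fromBits n b ≼ D₂
relabelsToOneOf⇒≼D₂ found with Any.satisfied found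
... | (_ , t≼D₂) , found-σ with Any.satisfied found-σ
...   | σ , relabels = ≼-respˡ-≅ (relabelling-≅ {σ = Vec.lookup σ} relabels) t≼D₂

-- The implicit argument is discharged by evaluating the check on every graph on Fin n.
classify-by-search : ∀ {n} targets σs →
  {True (∀-UpperBits? λ b → diamondLike? (fromBits n b) →-dec relabelsToOneOf? targets σs b)} →
  ∀ (b : UpperBits n) → DiamondLike (fromBits n b) → fromBits n b ≼ D₂
classify-by-search targets σs {complete} b diamondLike =
  relabelsToOneOf⇒≼D₂ (toWitness complete b diamondLike)

k₁ : UpperBits 1
k₁ = [] , tt

k₂ : UpperBits 2
k₂ = true ∷ [] , [] , tt

k₃ : UpperBits 3
k₃ = true ∷ true ∷ [] , true ∷ [] , [] , tt

-- The path 1 – 0 – 2.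
p₃ : UpperBits 3
p₃ = true ∷ true ∷ [] , false ∷ [] , [] , tt

D₂⟶K₃ : D₂ ⟶ fromBits 3 k₃
D₂⟶K₃ = contraction-by D₂ _ (# 0) (# 2) (Vec.lookup (# 0 ∷ # 1 ∷ # 0 ∷ # 2 ∷ []))

K₃⟶K₂ : fromBits 3 k₃ ⟶ fromBits 2 k₂
K₃⟶K₂ = contraction-by _ _ (# 0) (# 1) (Vec.lookup (# 0 ∷ # 0 ∷ # 1 ∷ []))

K₂⟶K₁ : fromBits 2 k₂ ⟶ fromBits 1 k₁
K₂⟶K₁ = contraction-by _ _ (# 0) (# 1) (Vec.lookup (# 0 ∷ # 0 ∷ []))

D₂⟶P₃ : D₂ ⟶ fromBits 3 p₃
D₂⟶P₃ = contraction-by D₂ _ (# 0) (# 1) (Vec.lookup (# 0 ∷ # 0 ∷ # 1 ∷ # 2 ∷ []))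

K₃≼D₂ : fromBits 3 k₃ ≼ D₂
K₃≼D₂ = step D₂⟶K₃ (iso ≅-refl)

K₂≼D₂ : fromBits 2 k₂ ≼ D₂
K₂≼D₂ = step D₂⟶K₃ (step K₃⟶K₂ (iso ≅-refl))

K₁≼D₂ : fromBits 1 k₁ ≼ D₂
K₁≼D₂ = step D₂⟶K₃ (step K₃⟶K₂ (step K₂⟶K₁ (iso ≅-refl)))

P₃≼D₂ : fromBits 3 p₃ ≼ D₂
P₃≼D₂ = step D₂⟶P₃ (iso ≅-refl)

fromBits-diamondLike⇒≼D₂ : ∀ n (b : UpperBits n) → DiamondLike (fromBits n b) → fromBits n b ≼ D₂
fromBits-diamondLike⇒≼D₂ 0 _ ((() , _) , _)
fromBits-diamondLike⇒≼D₂ 1 = classify-by-search ((k₁ , K₁≼D₂) ∷ []) ((# 0 ∷ []) ∷ [])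
fromBits-diamondLike⇒≼D₂ 2 = classify-by-search ((k₂ , K₂≼D₂) ∷ []) ((# 0 ∷ # 1 ∷ []) ∷ [])
fromBits-diamondLike⇒≼D₂ 3 = classify-by-search ((k₃ , K₃≼D₂) ∷ (p₃ , P₃≼D₂) ∷ [])
  ((# 0 ∷ # 1 ∷ # 2 ∷ []) ∷ (# 1 ∷ # 0 ∷ # 2 ∷ []) ∷ (# 2 ∷ # 1 ∷ # 0 ∷ []) ∷ [])
-- The six involutions moving each pair of vertices onto the non-edge {2, 3} of D₂.
fromBits-diamondLike⇒≼D₂ 4 = classify-by-search ((bitsOf 4 (adj D₂) , iso (≅-sym (≅-fromBits D₂))) ∷ [])
  ( (# 0 ∷ # 1 ∷ # 2 ∷ # 3 ∷ []) ∷ (# 2 ∷ # 3 ∷ # 0 ∷ # 1 ∷ [])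
  ∷ (# 3 ∷ # 1 ∷ # 2 ∷ # 0 ∷ []) ∷ (# 2 ∷ # 1 ∷ # 0 ∷ # 3 ∷ [])
  ∷ (# 0 ∷ # 3 ∷ # 2 ∷ # 1 ∷ []) ∷ (# 0 ∷ # 2 ∷ # 1 ∷ # 3 ∷ []) ∷ [])
fromBits-diamondLike⇒≼D₂ n@(suc (suc (suc (suc (suc m))))) b (_ , _ , cover , noTriple) =
  contradiction
    (ℕ.≤-trans (ℕ.m≤m+n 5 m) (vertexCover₂∧noIndependentTriple⇒size≤4 {fromBits n b} cover noTriple))
    (ℕ.<-irrefl refl)

diamondLike⇒≼D₂ : ∀ {H} → DiamondLike H → H ≼ D₂
diamondLike⇒≼D₂ {H} diamondLike = ≼-respˡ-≅ (≅-fromBits H)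
  (fromBits-diamondLike⇒≼D₂ (size H) _ (diamondLike-resp-≅ (≅-sym (≅-fromBits H)) diamondLike))

noAntichain⇒forced : ∀ {Q} → ≼-Closed Q → TwinFamily Q → (∀ G → Dec (Q G)) →
                     ∀ H → ¬ Antichain (Excl H) → HasUniversalVertex H × IsCompleteMultipartite H × Q H
noAntichain⇒forced Q-closed F Q? H noAntichain =
  decidable-stable (hasUniversalVertex? H ×-dec isCompleteMultipartite? H ×-dec Q? H)
                   (noAntichain ∘ excluding-antichain Q-closed F H)

corollary2 : (H : Graph) → WQO-≼ (Excl H) → H ≼ D₂
corollary2 H (_ , noAntichain)
  with noAntichain⇒forced vertexCover₂-closed K₂,ₙ-family hasVertexCover₂? H noAntichain
     | noAntichain⇒forced independence-closed cocktailParty-family noIndependentTriple? H noAntichain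
... | universal , multipartite , cover | _ , _ , noTriple =
  diamondLike⇒≼D₂ (universal , multipartite , cover , noTriple)
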